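{- For every $w\in S_n$, the Euler characteristic $\chi(w)$ of $w$ in the middle order lattice $\mathcal{P}_n$ equals the number of right-to-left non-minima of $w$. Moreover, for each $k$, the number of permutations of size $n$ with Euler characteristic $k$ is $c(n,n-k)$, the number of permutations of size $n$ having exactly $n-k$ cycles.
   Context: For $w\in S_n$ (one-line notation), its inversion sequence is $I(w)=(x_1,\ldots,x_n)$ with $x_i=\#\{j<i : w^{ -1}(j)>w^{ -1}(i)\}$. The middle order $\mathcal{P}_n$ is the poset on $S_n$ with $v\le w$ iff $I(v)\le I(w)$ coordinate-wise; it is a finite distributive lattice with minimum $\hat0$ the identity permutation. A valuation of a finite distributive lattice $L$ (with values in a commutative ring with identity) is a map $\nu$ with $\nu(\hat0)=0$ and $\nu(x)+\nu(y)=\nu(x\wedge y)+\nu(x\vee y)$ for all $x,y$; a valuation is uniquely determined by its (arbitrary) values on the join-irreducible elements (elements $a\ne\hat0$ such that $a=b\vee c$ implies $a\in\{b,c\}$). The Euler characteristic $\chi$ of $L$ is the unique valuation with $\chi(a)=1$ for every join-irreducible $a$. A right-to-left minimum of $w$ is a value $i$ such that no value smaller than $i$ appears to the right of $i$ in $w$; the other entries are right-to-left non-minima. -}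

module Defs where

open import Data.Nat as ℕ using (ℕ; zero; suc; _+_; _<_; _≤_; _⊓_; _⊔_)
open import Data.Fin using (Fin; toℕ)
open import Data.Fin.Properties using (any?; all?)
import Data.Fin.Properties as FinP
open import Data.Vec using (Vec; []; _∷_; lookup; tabulate)
open import Data.Vec.Membership.Propositional using (_∈_)
import Data.Vec.Relation.Unary.Any as VAny
open import Level using (0ℓ)
open import Data.List using (List; []; _∷_; length; filter; allFin; map; concatMap)
open import Data.Integer using (ℤ; +_)
open import Data.Product using (Σ; ∃; _×_; _,_)
open import Data.Sum using (_⊎_)
open import Relation.Nullary using (Dec; yes; no; ¬_)
open import Relation.Nullary.Decidable using (_×-dec_)
open import Relation.Unary using (Pred; Decidable)
open import Relation.Binary.PropositionalEquality using (_≡_)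

countL : ∀ {A : Set} {P : Pred A 0ℓ} → Decidable P → List A → ℕ
countL P? xs = length (filter P? xs)

countFin : ∀ {n} {P : Pred (Fin n) 0ℓ} → Decidable P → ℕ
countFin {n} P? = countL P? (allFin n)

-- Permutations in one-line notation (0-indexed): w = (w(0), …, w(n-1))

words : ∀ n m → List (Vec (Fin n) m)
words n zero    = [] ∷ []
words n (suc m) = concatMap (λ i → map (i ∷_) (words n m)) (allFin n)

-- w ∈ S_n : every letter occurs (w has length n, so it is a bijection)
IsPerm : ∀ {n} → Vec (Fin n) n → Set
IsPerm {n} w = ∀ (i : Fin n) → i ∈ w

isPerm? : ∀ {n} → Decidable (IsPerm {n})
isPerm? w = all? (λ i → VAny.any? (FinP._≟_ i) w)

countPerms : ∀ n {P : Pred (Vec (Fin n) n) 0ℓ} → Decidable P → ℕ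
countPerms n P? = countL (λ w → isPerm? w ×-dec P? w) (words n n)

-- the identity permutation (minimum 0̂ of the middle order)
idPerm : ∀ n → Vec (Fin n) n
idPerm n = tabulate (λ i → i)

-- position (as ℕ) of the first occurrence of i in a word (= w⁻¹(i) for a permutation)
pos : ∀ {n m} → Vec (Fin n) m → Fin n → ℕ
pos []      i = 0
pos (x ∷ w) i with FinP._≟_ x i
... | yes _ = 0
... | no  _ = suc (pos w i)

invSeq : ∀ {n} → Vec (Fin n) n → Fin n → ℕ
invSeq w i = countFin (λ j → (toℕ j ℕ.<? toℕ i) ×-dec (pos w i ℕ.<? pos w j))

-- The middle order lattice 𝒫_n: v ≤ w iff I(v) ≤ I(w) coordinatewise.
-- Inversion sequences form a product of chains, so meets/joins are the
-- permutations whose inversion sequences are coordinatewise min/max.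

IsMeet : ∀ {n} → (v w m : Vec (Fin n) n) → Set
IsMeet v w m = ∀ i → invSeq m i ≡ invSeq v i ⊓ invSeq w i

IsJoin : ∀ {n} → (v w j : Vec (Fin n) n) → Set
IsJoin v w j = ∀ i → invSeq j i ≡ invSeq v i ⊔ invSeq w i

JoinIrreducible : ∀ {n} → Vec (Fin n) n → Set
JoinIrreducible {n} a =
  IsPerm a × ¬ (a ≡ idPerm n) ×
  (∀ b c → IsPerm b → IsPerm c → IsJoin b c a → (a ≡ b) ⊎ (a ≡ c))

-- ℤ-valued valuations of 𝒫_n (values off S_n are irrelevant)
IsValuation : ∀ n → (Vec (Fin n) n → ℤ) → Set
IsValuation n ν =
  (ν (idPerm n) ≡ + 0) ×
  (∀ v w m j → IsPerm v → IsPerm w → IsPerm m → IsPerm j →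
     IsMeet v w m → IsJoin v w j → ν v Data.Integer.+ ν w ≡ ν m Data.Integer.+ ν j)

IsEulerChar : ∀ n → (Vec (Fin n) n → ℤ) → Set
IsEulerChar n χ = IsValuation n χ × (∀ a → JoinIrreducible a → χ a ≡ + 1)

rlNonMin : ∀ {n} → Vec (Fin n) n → ℕ
rlNonMin w = countFin (λ p → any? (λ q → (toℕ p ℕ.<? toℕ q) ×-dec
                                          (toℕ (lookup w q) ℕ.<? toℕ (lookup w p))))

-- Number of cycles of w (as the map i ↦ w(i)), counted by their minimal
-- elements: i is the least element of its cycle iff i ≤ w^m(i) for all m < n.

iter : ∀ {A : Set} → ℕ → (A → A) → A → A
iter zero    f x = x
iter (suc m) f x = f (iter m f x)

cycles : ∀ {n} → Vec (Fin n) n → ℕ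
cycles {n} w = countFin (λ i → all? (λ (m : Fin n) →
                 toℕ i ℕ.≤? toℕ (iter (toℕ m) (lookup w) i)))

{-# OPTIONS --safe #-}
-- The inversion sequence I(w) maps S_n bijectively onto the product of the chains
-- [0, i], and the middle order is the product order, so meets and joins are the
-- coordinatewise min and max. Splitting off one nonzero coordinate i writes any
-- w ≠ id as the join of a permutation with one fewer nonzero coordinate and the
-- permutation whose inversion sequence is supported on {i}, with meet id. The latter
-- permutations are the join-irreducibles, so by induction every valuation is
-- determined by its values on them, and χ(w) is the number of nonzero entries of
-- I(w). The value v is a right-to-left non-minimum iff a smaller value lies to its
-- right, i.e. iff I(w)_v > 0.
--
-- Every w ∈ S_{n+1} arises uniquely by inserting the maximum n into some u ∈ S_n at
-- a position k: either into the one-line notation, which adds a right-to-left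
-- non-minimum iff k ≠ n, or into the cycle of k right after k (a new fixed point if
-- k = n), which adds a cycle iff k = n. Matching the two insertions recursively
-- gives a bijection Θ of S_n with rlNonMin w + cycles (Θ w) = n.

module Submission where

open import Defs
open import Level using (0ℓ)
open import Data.Nat as ℕ using (ℕ; zero; suc; _+_; _*_; _∸_; _<_; _≤_; z≤n; s≤s; _⊓_; _⊔_)
import Data.Nat.Properties as ℕP
open import Data.Nat.DivMod using (_mod_; _%_; _/_; m<n⇒m%n≡m; m%n<n; m≡m%n+[m/n]*n)
open import Data.Fin as Fin using (Fin; toℕ; fromℕ; fromℕ<; inject₁; punchIn; punchOut)
import Data.Fin.Properties as FinP
open import Data.Fin.Permutation as Perm using (Permutation′; _⟨$⟩ʳ_; _⟨$⟩ˡ_)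
import Data.Fin.Permutation.Components as PC
open import Data.Fin.Relation.Unary.Top using (view; ‵fromℕ; ‵inject₁; view-fromℕ; view-inject₁)
import Data.List as List
open import Data.List using (List; []; _∷_)
import Data.List.Properties as ListP
import Data.List.Relation.Unary.Any as ListAny
open import Data.List.Relation.Unary.All as All using (All)
import Data.List.Relation.Unary.All.Properties as AllP
import Data.List.Relation.Unary.AllPairs as AllPairs
import Data.List.Relation.Unary.AllPairs.Properties as AllPairsP
open import Data.List.Relation.Unary.Unique.Propositional using (Unique)
import Data.List.Relation.Unary.Unique.Propositional.Properties as UniqueP
open import Data.List.Relation.Binary.Disjoint.Propositional using (Disjoint)
open import Data.List.Membership.Propositional using () renaming (_∈_ to _∈ₗ_)
import Data.List.Membership.Propositional.Properties as ListMemP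
open import Data.List.Membership.Propositional.Properties.WithK using (unique∧set⇒bag)
open import Data.List.Relation.Binary.BagAndSetEquality using (_∼[_]_; bag; ∼bag⇒↭)
import Data.List.Relation.Binary.Permutation.Propositional.Properties as PermP
open import Data.Vec using (Vec; []; _∷_; lookup; tabulate)
import Data.Vec.Properties as VecP
import Data.Vec.Relation.Unary.Any as VAny
import Data.Vec.Relation.Unary.Any.Properties as VAnyP
open import Data.Vec.Membership.Propositional using (_∈_)
open import Data.Vec.Membership.Propositional.Properties using (∈-lookup)
open import Data.Integer as ℤ using (ℤ; +_)
import Data.Integer.Properties as ℤP
open import Data.Product using (Σ; ∃; _×_; _,_; proj₁; proj₂)
open import Data.Sum using (_⊎_; inj₁; inj₂)
open import Function using (_∘_; id; _⇔_; mk⇔; Equivalence)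
open import Function.Definitions using (Injective)
open import Function.Construct.Composition using (_⇔-∘_)
open import Function.Construct.Symmetry using (⇔-sym)
open import Relation.Nullary using (Dec; yes; no; ¬_; contradiction)
open import Relation.Nullary.Decidable using (_×-dec_; dec-true; dec-false)
open import Relation.Unary using (Pred; Decidable)
open import Relation.Binary.PropositionalEquality
open import Induction.WellFounded using (Acc; acc)
open import Algebra.Properties.CommutativeSemigroup ℕP.+-commutativeSemigroup using () renaming (interchange to +-interchange)
open import Data.Nat.Induction using (<-wellFounded)
open import Algebra.Properties.CommutativeMonoid.Sum ℕP.+-0-commutativeMonoid
  using (sum-syntax; sum-cong-≗; sum-replicate-zero; sum-init-last; sum-remove; ∑-distrib-+; sum-permute)

private
  variable
    m n : ℕ
    P Q : Set

𝟙 : Dec P → ℕ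
𝟙 (yes _) = 1
𝟙 (no _)  = 0

𝟙-yes : (p : Dec P) → P → 𝟙 p ≡ 1
𝟙-yes (yes _) _  = refl
𝟙-yes (no ¬p) p = contradiction p ¬p

𝟙-no : (p : Dec P) → ¬ P → 𝟙 p ≡ 0
𝟙-no (yes p) ¬p = contradiction p ¬p
𝟙-no (no _)  _  = refl

𝟙-cong : (p : Dec P) (q : Dec Q) → P ⇔ Q → 𝟙 p ≡ 𝟙 q
𝟙-cong (yes _) (yes _) _   = refl
𝟙-cong (no _)  (no _)  _   = refl
𝟙-cong (yes p) (no ¬q) P⇔Q = contradiction (Equivalence.to P⇔Q p) ¬q
𝟙-cong (no ¬p) (yes q) P⇔Q = contradiction (Equivalence.from P⇔Q q) ¬p

countL-tabulate : ∀ {A : Set} {P : Pred A 0ℓ} (P? : Decidable P) (f : Fin n → A) →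
                  countL P? (List.tabulate f) ≡ ∑[ i < n ] 𝟙 (P? (f i))
countL-tabulate {zero}  P? f = refl
countL-tabulate {suc n} P? f with P? (f Fin.zero)
... | yes _ = cong suc (countL-tabulate P? (f ∘ Fin.suc))
... | no _  = countL-tabulate P? (f ∘ Fin.suc)

countFin≡∑𝟙 : {P : Pred (Fin n) 0ℓ} (P? : Decidable P) → countFin P? ≡ ∑[ i < n ] 𝟙 (P? i)
countFin≡∑𝟙 P? = countL-tabulate P? id

∑-zero : {f : Fin n → ℕ} → (∀ i → f i ≡ 0) → ∑[ i < n ] f i ≡ 0
∑-zero {n} f≗0 = trans (sum-cong-≗ f≗0) (sum-replicate-zero n)

term≤∑ : (f : Fin n → ℕ) (i : Fin n) → f i ≤ ∑[ j < n ] f j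
term≤∑ f Fin.zero    = ℕP.m≤m+n _ _
term≤∑ f (Fin.suc i) = ℕP.≤-trans (term≤∑ (f ∘ Fin.suc) i) (ℕP.m≤n+m _ (f Fin.zero))

∑-single : {f : Fin n → ℕ} (i : Fin n) → (∀ j → j ≢ i → f j ≡ 0) → ∑[ j < n ] f j ≡ f i
∑-single {suc n} {f} i off-i = begin
  ∑[ j < suc n ] f j                 ≡⟨ sum-remove {i = i} f ⟩
  f i + ∑[ j < n ] f (punchIn i j)  ≡⟨ cong (_+_ (f i)) (∑-zero (λ j → off-i _ (FinP.punchInᵢ≢i i j))) ⟩
  f i + 0                           ≡⟨ ℕP.+-identityʳ (f i) ⟩
  f i                               ∎
  where open ≡-Reasoning

0<∑𝟙⇔∃ : {P : Pred (Fin n) 0ℓ} (P? : Decidable P) → 0 < ∑[ i < n ] 𝟙 (P? i) ⇔ ∃ P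
0<∑𝟙⇔∃ P? = mk⇔ to from
  where
  to : 0 < ∑[ i < _ ] 𝟙 (P? i) → ∃ _
  to 0<∑ with FinP.any? P?
  ... | yes witness = witness
  ... | no ¬witness = contradiction (∑-zero (λ i → 𝟙-no (P? i) (λ Pi → ¬witness (i , Pi)))) (ℕP.>⇒≢ 0<∑)
  from : ∃ _ → 0 < ∑[ i < _ ] 𝟙 (P? i)
  from (i , Pi) = ℕP.<-≤-trans (ℕP.≤-reflexive (sym (𝟙-yes (P? i) Pi))) (term≤∑ (𝟙 ∘ P?) i)

∑-atLeast : ∀ n k → ∑[ q < n ] 𝟙 (k ℕ.≤? toℕ q) ≡ n ∸ k
∑-atLeast zero    k       = sym (ℕP.0∸n≡0 k)
∑-atLeast (suc n) zero    =
  trans (sum-cong-≗ {suc n} {y = λ _ → 1} (λ q → 𝟙-yes (0 ℕ.≤? toℕ q) z≤n)) (∑-ones (suc n))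
  where
  ∑-ones : ∀ n → ∑[ q < n ] 1 ≡ n
  ∑-ones zero    = refl
  ∑-ones (suc n) = cong suc (∑-ones n)
∑-atLeast (suc n) (suc k) = trans (sum-cong-≗ {n} shift) (∑-atLeast n k)
  where
  shift : ∀ q → 𝟙 (suc k ℕ.≤? toℕ (Fin.suc q)) ≡ 𝟙 (k ℕ.≤? toℕ q)
  shift q = 𝟙-cong (_ ℕ.≤? _) (_ ℕ.≤? _) (mk⇔ ℕ.s≤s⁻¹ s≤s)

injective⇒surjective : {f : Fin n → Fin n} → Injective _≡_ _≡_ f → ∀ y → ∃ λ x → f x ≡ y
injective⇒surjective {zero} _ ()
injective⇒surjective {suc n} {f} f-inj y with FinP.any? (λ x → f x FinP.≟ y)
... | yes hit  = hit
... | no ¬hit = contradiction (FinP.injective⇒≤ g-inj) ℕP.1+n≰n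
  where
  g : Fin (suc n) → Fin n
  g x = punchOut {i = y} {j = f x} (λ y≡fx → ¬hit (x , sym y≡fx))
  g-inj : Injective _≡_ _≡_ g
  g-inj eq = f-inj (FinP.punchOut-injective {i = y} _ _ eq)

pos-lookup : {w : Vec (Fin n) m} → Injective _≡_ _≡_ (lookup w) → ∀ p → pos w (lookup w p) ≡ toℕ p
pos-lookup {w = x ∷ w} inj Fin.zero with x FinP.≟ x
... | yes _   = refl
... | no x≢x = contradiction refl x≢x
pos-lookup {w = x ∷ w} inj (Fin.suc p) with x FinP.≟ lookup w p
... | yes x≡wp = contradiction (inj {Fin.zero} {Fin.suc p} x≡wp) λ ()
... | no _     = cong suc (pos-lookup {w = w} (FinP.suc-injective ∘ inj) p)

module _ {w : Vec (Fin n) n} (w-perm : IsPerm w) where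

  position : Fin n → Fin n
  position j = VAny.index (w-perm j)

  lookup-position : ∀ j → lookup w (position j) ≡ j
  lookup-position j = sym (VAnyP.lookup-index (w-perm j))

  position-injective : Injective _≡_ _≡_ position
  position-injective {a} {b} eq =
    trans (sym (lookup-position a)) (trans (cong (lookup w) eq) (lookup-position b))

  lookup-injective : Injective _≡_ _≡_ (lookup w)
  lookup-injective {p} {q} wp≡wq
    with a , refl ← injective⇒surjective position-injective p
       | b , refl ← injective⇒surjective position-injective q
    = cong position (trans (sym (lookup-position a)) (trans wp≡wq (lookup-position b)))

  position-lookup : ∀ p → position (lookup w p) ≡ p
  position-lookup p = lookup-injective (lookup-position (lookup w p))

  pos≡position : ∀ j → pos w j ≡ toℕ (position j)
  pos≡position j = trans (cong (pos w) (sym (lookup-position j))) (pos-lookup {w = w} lookup-injective (position j))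

  ∑-reindex-lookup : (f : Fin n → ℕ) → ∑[ p < n ] f (lookup w p) ≡ ∑[ j < n ] f j
  ∑-reindex-lookup f = sym (sum-permute f (Perm.permutation (lookup w) position lookup-position position-lookup))

  ∑-reindex-position : (f : Fin n → ℕ) → ∑[ j < n ] f (position j) ≡ ∑[ p < n ] f p
  ∑-reindex-position f = sym (sum-permute f (Perm.permutation position (lookup w) position-lookup lookup-position))

lookup-ext : {A : Set} {v w : Vec A n} → (∀ p → lookup v p ≡ lookup w p) → v ≡ w
lookup-ext {v = v} {w} v≗w =
  trans (sym (VecP.tabulate∘lookup v)) (trans (VecP.tabulate-cong v≗w) (VecP.tabulate∘lookup w))

-- Inserting a new maximum

extend : Vec (Fin n) n → Fin (suc n) → Fin (suc n)
extend {n} u p with view p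
... | ‵fromℕ     = fromℕ n
... | ‵inject₁ q = inject₁ (lookup u q)

extend-fromℕ : (u : Vec (Fin n) n) → extend u (fromℕ n) ≡ fromℕ n
extend-fromℕ {n} u rewrite view-fromℕ n = refl

extend-inject₁ : (u : Vec (Fin n) n) (q : Fin n) → extend u (inject₁ q) ≡ inject₁ (lookup u q)
extend-inject₁ u q rewrite view-inject₁ q = refl

extend≡fromℕ⇒ : (u : Vec (Fin n) n) (p : Fin (suc n)) → extend u p ≡ fromℕ n → p ≡ fromℕ n
extend≡fromℕ⇒ u p with view p
... | ‵fromℕ     = λ _ → refl
... | ‵inject₁ q = λ eq → contradiction (sym eq) FinP.fromℕ≢inject₁

extend≡inject₁⇒∈ : (u : Vec (Fin n) n) (p : Fin (suc n)) {v : Fin n} → extend u p ≡ inject₁ v → v ∈ u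
extend≡inject₁⇒∈ u p with view p
... | ‵fromℕ     = λ eq → contradiction eq FinP.fromℕ≢inject₁
... | ‵inject₁ q = λ eq → subst (_∈ u) (FinP.inject₁-injective eq) (∈-lookup q u)

-- The inverse of inject₁, sending the top element to the junk value d.
lowerOr : Fin n → Fin (suc n) → Fin n
lowerOr d p with view p
... | ‵fromℕ     = d
... | ‵inject₁ q = q

lowerOr-inject₁ : (d q : Fin n) → lowerOr d (inject₁ q) ≡ q
lowerOr-inject₁ d q rewrite view-inject₁ q = refl

inject₁-lowerOr : (d : Fin n) (p : Fin (suc n)) → p ≢ fromℕ n → inject₁ (lowerOr d p) ≡ p
inject₁-lowerOr d p with view p
... | ‵fromℕ     = λ p≢top → contradiction refl p≢top
... | ‵inject₁ q = λ _ → refl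

toℕ-mod : m < suc n → toℕ (m mod suc n) ≡ m
toℕ-mod m<1+n = trans (FinP.toℕ-fromℕ< _) (m<n⇒m%n≡m m<1+n)

mod-toℕ : (k : Fin (suc n)) → toℕ k mod suc n ≡ k
mod-toℕ k = FinP.toℕ-injective (toℕ-mod (FinP.toℕ<n k))

-- `pos` is ℕ-valued; `mod` brings it into Fin (suc n) and fixes every actual position.
topPosition : Vec (Fin (suc n)) (suc n) → Fin (suc n)
topPosition {n} w = pos w (fromℕ n) mod suc n

module _ {w : Vec (Fin (suc n)) (suc n)} (w-perm : IsPerm w) where

  topPosition≡position : topPosition w ≡ position w-perm (fromℕ n)
  topPosition≡position = trans (cong (_mod suc n) (pos≡position w-perm (fromℕ n))) (mod-toℕ _)

  lookup-topPosition : lookup w (topPosition w) ≡ fromℕ n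
  lookup-topPosition = trans (cong (lookup w) topPosition≡position) (lookup-position w-perm (fromℕ n))

-- `insert u k` puts the new maximum n at position k, and u(q) at the position that
-- `placement k` sends to inject₁ q.
record TopInsertion : Set where
  field
    placement     : ∀ {n} → Fin (suc n) → Permutation′ (suc n)
    placement-top : ∀ {n} (k : Fin (suc n)) → placement k ⟨$⟩ʳ k ≡ fromℕ n

  placement≡top⇒ : ∀ {n} {k p : Fin (suc n)} → placement k ⟨$⟩ʳ p ≡ fromℕ n → p ≡ k
  placement≡top⇒ {k = k} {p} eq = begin
    p                                         ≡⟨ Perm.inverseˡ (placement k) ⟨
    placement k ⟨$⟩ˡ (placement k ⟨$⟩ʳ p)     ≡⟨ cong (placement k ⟨$⟩ˡ_) (trans eq (sym (placement-top k))) ⟩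
    placement k ⟨$⟩ˡ (placement k ⟨$⟩ʳ k)     ≡⟨ Perm.inverseˡ (placement k) ⟩
    k                                         ∎
    where open ≡-Reasoning

module Insertion (ι : TopInsertion) where
  open TopInsertion ι public

  insert : Vec (Fin n) n → Fin (suc n) → Vec (Fin (suc n)) (suc n)
  insert u k = tabulate (λ p → extend u (placement k ⟨$⟩ʳ p))

  remove : Vec (Fin (suc n)) (suc n) → Vec (Fin n) n
  remove w = tabulate (λ q → lowerOr q (lookup w (placement (topPosition w) ⟨$⟩ˡ inject₁ q)))

  module _ (u : Vec (Fin n) n) (k : Fin (suc n)) where

    lookup-insert : ∀ p → lookup (insert u k) p ≡ extend u (placement k ⟨$⟩ʳ p)
    lookup-insert p = VecP.lookup∘tabulate (λ p → extend u (placement k ⟨$⟩ʳ p)) p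

    lookup-insert-top : lookup (insert u k) k ≡ fromℕ n
    lookup-insert-top = trans (lookup-insert k) (trans (cong (extend u) (placement-top k)) (extend-fromℕ u))

    lookup-insert-inject₁ : ∀ q → lookup (insert u k) (placement k ⟨$⟩ˡ inject₁ q) ≡ inject₁ (lookup u q)
    lookup-insert-inject₁ q =
      trans (lookup-insert (placement k ⟨$⟩ˡ inject₁ q))
        (trans (cong (extend u) (Perm.inverseʳ (placement k))) (extend-inject₁ u q))

    insert-isPerm : IsPerm u → IsPerm (insert u k)
    insert-isPerm u-perm v with view v
    ... | ‵fromℕ     = subst (_∈ insert u k) lookup-insert-top (∈-lookup k (insert u k))
    ... | ‵inject₁ j = subst (_∈ insert u k)
      (trans (lookup-insert-inject₁ (position u-perm j)) (cong inject₁ (lookup-position u-perm j)))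
      (∈-lookup (placement k ⟨$⟩ˡ inject₁ (position u-perm j)) (insert u k))

    insert-isPerm⁻ : IsPerm (insert u k) → IsPerm u
    insert-isPerm⁻ w-perm v = extend≡inject₁⇒∈ u (placement k ⟨$⟩ʳ p)
      (trans (sym (lookup-insert p)) (lookup-position w-perm (inject₁ v)))
      where p = position w-perm (inject₁ v)

    module _ (u-perm : IsPerm u) where

      pos-insert-top : pos (insert u k) (fromℕ n) ≡ toℕ k
      pos-insert-top = trans (cong (pos (insert u k)) (sym lookup-insert-top))
        (pos-lookup {w = insert u k} (lookup-injective (insert-isPerm u-perm)) k)

      pos-insert-inject₁ : ∀ j → pos (insert u k) (inject₁ j) ≡ toℕ (placement k ⟨$⟩ˡ inject₁ (position u-perm j))
      pos-insert-inject₁ j = trans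
        (cong (pos (insert u k)) (trans (cong inject₁ (sym (lookup-position u-perm j))) (sym (lookup-insert-inject₁ _))))
        (pos-lookup {w = insert u k} (lookup-injective (insert-isPerm u-perm)) _)

      topPosition-insert : topPosition (insert u k) ≡ k
      topPosition-insert = trans (cong (_mod suc n) pos-insert-top) (mod-toℕ k)

      remove-insert : remove (insert u k) ≡ u
      remove-insert = lookup-ext λ q → begin
        lookup (remove (insert u k)) q
          ≡⟨ VecP.lookup∘tabulate _ q ⟩
        lowerOr q (lookup (insert u k) (placement (topPosition (insert u k)) ⟨$⟩ˡ inject₁ q))
          ≡⟨ cong (λ k′ → lowerOr q (lookup (insert u k) (placement k′ ⟨$⟩ˡ inject₁ q))) topPosition-insert ⟩
        lowerOr q (lookup (insert u k) (placement k ⟨$⟩ˡ inject₁ q))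
          ≡⟨ cong (lowerOr q) (lookup-insert-inject₁ q) ⟩
        lowerOr q (inject₁ (lookup u q))
          ≡⟨ lowerOr-inject₁ q (lookup u q) ⟩
        lookup u q
          ∎
        where open ≡-Reasoning

  module _ {w : Vec (Fin (suc n)) (suc n)} (w-perm : IsPerm w) where

    insert-remove : insert (remove w) (topPosition w) ≡ w
    insert-remove = lookup-ext λ p → trans (lookup-insert _ k p) (extend-remove p _ refl)
      where
      k = topPosition w
      extend-remove : ∀ p r → placement k ⟨$⟩ʳ p ≡ r → extend (remove w) r ≡ lookup w p
      extend-remove p r eq with view r
      ... | ‵fromℕ = begin
        fromℕ n                     ≡⟨ lookup-topPosition w-perm ⟨
        lookup w k                  ≡⟨ cong (lookup w) (placement≡top⇒ eq) ⟨
        lookup w p                  ∎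
        where open ≡-Reasoning
      ... | ‵inject₁ q = begin
        inject₁ (lookup (remove w) q)
          ≡⟨ cong inject₁ (VecP.lookup∘tabulate _ q) ⟩
        inject₁ (lowerOr q (lookup w (placement k ⟨$⟩ˡ inject₁ q)))
          ≡⟨ cong (λ r → inject₁ (lowerOr q (lookup w r))) p≡ ⟨
        inject₁ (lowerOr q (lookup w p))
          ≡⟨ inject₁-lowerOr q (lookup w p) wp≢top ⟩
        lookup w p
          ∎
        where
        open ≡-Reasoning
        p≡ : p ≡ placement k ⟨$⟩ˡ inject₁ q
        p≡ = trans (sym (Perm.inverseˡ (placement k))) (cong (placement k ⟨$⟩ˡ_) eq)
        wp≢top : lookup w p ≢ fromℕ n
        wp≢top wp≡top = FinP.fromℕ≢inject₁ (trans (sym (placement-top k)) (trans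
          (cong (placement k ⟨$⟩ʳ_) (lookup-injective w-perm (trans (lookup-topPosition w-perm) (sym wp≡top)))) eq))

    remove-isPerm : IsPerm (remove w)
    remove-isPerm = insert-isPerm⁻ _ _ (subst IsPerm (sym insert-remove) w-perm)

punchIn-fromℕ : (q : Fin n) → punchIn (fromℕ n) q ≡ inject₁ q
punchIn-fromℕ Fin.zero    = refl
punchIn-fromℕ (Fin.suc q) = cong Fin.suc (punchIn-fromℕ q)

punchIn-<⇔ : (k : Fin (suc n)) (a b : Fin n) → toℕ (punchIn k a) < toℕ (punchIn k b) ⇔ toℕ a < toℕ b
punchIn-<⇔ k a b = mk⇔
  (λ lt → ℕP.≰⇒> (λ b≤a → ℕP.<⇒≱ lt (FinP.punchIn-mono-≤ k b a b≤a)))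
  (λ lt → ℕP.≰⇒> (λ b≤a → ℕP.<⇒≱ lt (FinP.punchIn-cancel-≤ k b a b≤a)))

<punchIn⇔≤ : (k : Fin (suc n)) (a : Fin n) → toℕ k < toℕ (punchIn k a) ⇔ toℕ k ≤ toℕ a
<punchIn⇔≤ k a = mk⇔ (to k a) (from k a)
  where
  to : ∀ {n} (k : Fin (suc n)) a → toℕ k < toℕ (punchIn k a) → toℕ k ≤ toℕ a
  to Fin.zero    a           _         = z≤n
  to (Fin.suc k) (Fin.suc a) (s≤s lt) = s≤s (to k a lt)
  from : ∀ {n} (k : Fin (suc n)) a → toℕ k ≤ toℕ a → toℕ k < toℕ (punchIn k a)
  from Fin.zero    a           _         = s≤s z≤n
  from (Fin.suc k) (Fin.suc a) (s≤s le) = s≤s (from k a le)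

oneLineInsertion : TopInsertion
oneLineInsertion = record
  { placement     = λ k → Perm.insert k (fromℕ _) Perm.id
  ; placement-top = insert-self
  }
  where
  insert-self : (k : Fin (suc n)) → Perm.insert k (fromℕ n) Perm.id ⟨$⟩ʳ k ≡ fromℕ n
  insert-self k with k FinP.≟ k
  ... | yes _   = refl
  ... | no k≢k = contradiction refl k≢k

module OneLine = Insertion oneLineInsertion

oneLine-placement⁻¹ : (k : Fin (suc n)) (q : Fin n) → OneLine.placement k ⟨$⟩ˡ inject₁ q ≡ punchIn k q
oneLine-placement⁻¹ {n} k q = begin
  π ⟨$⟩ˡ inject₁ q               ≡⟨ cong (π ⟨$⟩ˡ_) (punchIn-fromℕ q) ⟨
  π ⟨$⟩ˡ punchIn (fromℕ n) q     ≡⟨ cong (π ⟨$⟩ˡ_) (Perm.insert-punchIn k (fromℕ n) Perm.id q) ⟨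
  π ⟨$⟩ˡ (π ⟨$⟩ʳ punchIn k q)    ≡⟨ Perm.inverseˡ π ⟩
  punchIn k q                    ∎
  where
  open ≡-Reasoning
  π = OneLine.placement k

-- Inversion sequences

-- σ v is the position of the value v, as for `pos`.
inversion? : (σ : Fin n → ℕ) (i j : Fin n) → Dec (toℕ j < toℕ i × σ i < σ j)
inversion? σ i j = (toℕ j ℕ.<? toℕ i) ×-dec (σ i ℕ.<? σ j)

inversionsAt : (Fin n → ℕ) → Fin n → ℕ
inversionsAt {n} σ i = ∑[ j < n ] 𝟙 (inversion? σ i j)

invSeq≡inversionsAt : (w : Vec (Fin n) n) (i : Fin n) → invSeq w i ≡ inversionsAt (pos w) i
invSeq≡inversionsAt w i = countFin≡∑𝟙 (inversion? (pos w) i)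

inversionsAt-cong : {σ τ : Fin n → ℕ} → (∀ i j → σ i < σ j ⇔ τ i < τ j) →
                    ∀ i → inversionsAt σ i ≡ inversionsAt τ i
inversionsAt-cong {n} {σ} {τ} σ∼τ i = sum-cong-≗ {n} λ j → 𝟙-cong (inversion? σ i j) (inversion? τ i j)
  (mk⇔ (λ (j<i , lt) → j<i , Equivalence.to (σ∼τ i j) lt) (λ (j<i , lt) → j<i , Equivalence.from (σ∼τ i j) lt))

inversionsAt-inject₁ : (σ : Fin (suc n) → ℕ) (i : Fin n) →
                       inversionsAt σ (inject₁ i) ≡ inversionsAt (σ ∘ inject₁) i
inversionsAt-inject₁ {n} σ i = begin
  inversionsAt σ (inject₁ i)
    ≡⟨ sum-init-last {n} (𝟙 ∘ term) ⟩
  ∑[ j < n ] 𝟙 (term (inject₁ j)) + 𝟙 (term (fromℕ n))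
    ≡⟨ cong₂ _+_ (sum-cong-≗ {n} (λ j → 𝟙-cong (term (inject₁ j)) (inversion? (σ ∘ inject₁) i j) (inject₁-⇔ j)))
                 (𝟙-no (term (fromℕ n)) (λ (top<i , _) → ℕP.<-asym top<i i<top)) ⟩
  inversionsAt (σ ∘ inject₁) i + 0
    ≡⟨ ℕP.+-identityʳ _ ⟩
  inversionsAt (σ ∘ inject₁) i
    ∎
  where
  open ≡-Reasoning
  term = inversion? σ (inject₁ i)
  i<top : toℕ (inject₁ i) < toℕ (fromℕ n)
  i<top = subst (toℕ (inject₁ i) <_) (sym (FinP.toℕ-fromℕ n)) (FinP.inject₁ℕ< i)
  inject₁-⇔ : ∀ j → (toℕ (inject₁ j) < toℕ (inject₁ i) × σ (inject₁ i) < σ (inject₁ j))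
                  ⇔ (toℕ j < toℕ i × σ (inject₁ i) < σ (inject₁ j))
  inject₁-⇔ j = mk⇔ (λ (j<i , lt) → subst₂ _<_ (FinP.toℕ-inject₁ j) (FinP.toℕ-inject₁ i) j<i , lt)
                    (λ (j<i , lt) → subst₂ _<_ (sym (FinP.toℕ-inject₁ j)) (sym (FinP.toℕ-inject₁ i)) j<i , lt)

inversionsAt-fromℕ : (σ : Fin (suc n) → ℕ) →
                     inversionsAt σ (fromℕ n) ≡ ∑[ j < n ] 𝟙 (σ (fromℕ n) ℕ.<? σ (inject₁ j))
inversionsAt-fromℕ {n} σ = begin
  inversionsAt σ (fromℕ n)
    ≡⟨ sum-init-last {n} (𝟙 ∘ term) ⟩
  ∑[ j < n ] 𝟙 (term (inject₁ j)) + 𝟙 (term (fromℕ n))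
    ≡⟨ cong₂ _+_ (sum-cong-≗ {n} (λ j → 𝟙-cong (term (inject₁ j)) (σ (fromℕ n) ℕ.<? σ (inject₁ j)) (drop-< j)))
                 (𝟙-no (term (fromℕ n)) (λ (top<top , _) → ℕP.<-irrefl refl top<top)) ⟩
  ∑[ j < n ] 𝟙 (σ (fromℕ n) ℕ.<? σ (inject₁ j)) + 0
    ≡⟨ ℕP.+-identityʳ _ ⟩
  ∑[ j < n ] 𝟙 (σ (fromℕ n) ℕ.<? σ (inject₁ j))
    ∎
  where
  open ≡-Reasoning
  term = inversion? σ (fromℕ n)
  drop-< : ∀ j → (toℕ (inject₁ j) < toℕ (fromℕ n) × σ (fromℕ n) < σ (inject₁ j)) ⇔ σ (fromℕ n) < σ (inject₁ j)
  drop-< j = mk⇔ proj₂ (λ lt → subst (toℕ (inject₁ j) <_) (sym (FinP.toℕ-fromℕ n)) (FinP.inject₁ℕ< j) , lt)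

module _ {u : Vec (Fin n) n} (u-perm : IsPerm u) (k : Fin (suc n)) where

  private
    w = OneLine.insert u k

  pos-oneLine-inject₁ : ∀ j → pos w (inject₁ j) ≡ toℕ (punchIn k (position u-perm j))
  pos-oneLine-inject₁ j = trans (OneLine.pos-insert-inject₁ u k u-perm j) (cong toℕ (oneLine-placement⁻¹ k _))

  invSeq-oneLine-inject₁ : ∀ i → invSeq w (inject₁ i) ≡ invSeq u i
  invSeq-oneLine-inject₁ i = begin
    invSeq w (inject₁ i)              ≡⟨ invSeq≡inversionsAt w (inject₁ i) ⟩
    inversionsAt (pos w) (inject₁ i)  ≡⟨ inversionsAt-inject₁ (pos w) i ⟩
    inversionsAt (pos w ∘ inject₁) i  ≡⟨ inversionsAt-cong order i ⟩
    inversionsAt (pos u) i            ≡⟨ invSeq≡inversionsAt u i ⟨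
    invSeq u i                        ∎
    where
    open ≡-Reasoning
    order : ∀ i j → pos w (inject₁ i) < pos w (inject₁ j) ⇔ pos u i < pos u j
    order i j rewrite pos-oneLine-inject₁ i | pos-oneLine-inject₁ j
                    | pos≡position u-perm i | pos≡position u-perm j = punchIn-<⇔ k _ _

  invSeq-oneLine-fromℕ : invSeq w (fromℕ n) ≡ n ∸ toℕ k
  invSeq-oneLine-fromℕ = begin
    invSeq w (fromℕ n)
      ≡⟨ invSeq≡inversionsAt w (fromℕ n) ⟩
    inversionsAt (pos w) (fromℕ n)
      ≡⟨ inversionsAt-fromℕ (pos w) ⟩
    ∑[ j < n ] 𝟙 (pos w (fromℕ n) ℕ.<? pos w (inject₁ j))
      ≡⟨ sum-cong-≗ {n} (λ j → 𝟙-cong _ _ (after-k j)) ⟩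
    ∑[ j < n ] 𝟙 (toℕ k ℕ.≤? toℕ (position u-perm j))
      ≡⟨ ∑-reindex-position u-perm (λ q → 𝟙 (toℕ k ℕ.≤? toℕ q)) ⟩
    ∑[ q < n ] 𝟙 (toℕ k ℕ.≤? toℕ q)
      ≡⟨ ∑-atLeast n (toℕ k) ⟩
    n ∸ toℕ k
      ∎
    where
    open ≡-Reasoning
    after-k : ∀ j → pos w (fromℕ n) < pos w (inject₁ j) ⇔ toℕ k ≤ toℕ (position u-perm j)
    after-k j rewrite OneLine.pos-insert-top u k u-perm | pos-oneLine-inject₁ j = <punchIn⇔≤ k _

module _ {w : Vec (Fin (suc n)) (suc n)} (w-perm : IsPerm w) where

  private
    rest-perm = OneLine.remove-isPerm w-perm

  invSeq-inject₁ : ∀ i → invSeq w (inject₁ i) ≡ invSeq (OneLine.remove w) i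
  invSeq-inject₁ i = trans (cong (λ v → invSeq v (inject₁ i)) (sym (OneLine.insert-remove w-perm)))
                           (invSeq-oneLine-inject₁ rest-perm (topPosition w) i)

  invSeq-fromℕ : invSeq w (fromℕ n) ≡ n ∸ toℕ (topPosition w)
  invSeq-fromℕ = trans (cong (λ v → invSeq v (fromℕ n)) (sym (OneLine.insert-remove w-perm)))
                       (invSeq-oneLine-fromℕ rest-perm (topPosition w))

invSeq-injective : {v w : Vec (Fin n) n} → IsPerm v → IsPerm w → (∀ i → invSeq v i ≡ invSeq w i) → v ≡ w
invSeq-injective {zero}  {[]} {[]} _ _ _ = refl
invSeq-injective {suc n} {v}  {w}  v-perm w-perm Iv≗Iw = begin
  v                                                  ≡⟨ OneLine.insert-remove v-perm ⟨
  OneLine.insert (OneLine.remove v) (topPosition v)  ≡⟨ cong₂ OneLine.insert same-rest same-top ⟩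
  OneLine.insert (OneLine.remove w) (topPosition w)  ≡⟨ OneLine.insert-remove w-perm ⟩
  w                                                  ∎
  where
  open ≡-Reasoning
  same-top : topPosition v ≡ topPosition w
  same-top = FinP.toℕ-injective
    (ℕP.∸-cancelˡ-≡ (FinP.toℕ≤pred[n] (topPosition v)) (FinP.toℕ≤pred[n] (topPosition w))
      (trans (sym (invSeq-fromℕ v-perm)) (trans (Iv≗Iw (fromℕ n)) (invSeq-fromℕ w-perm))))
  same-rest : OneLine.remove v ≡ OneLine.remove w
  same-rest = invSeq-injective (OneLine.remove-isPerm v-perm) (OneLine.remove-isPerm w-perm)
    (λ i → trans (sym (invSeq-inject₁ v-perm i)) (trans (Iv≗Iw (inject₁ i)) (invSeq-inject₁ w-perm i)))

IsInversionSequence : (Fin n → ℕ) → Set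
IsInversionSequence x = ∀ i → x i ≤ toℕ i

invSeq-isInversionSequence : {w : Vec (Fin n) n} → IsPerm w → IsInversionSequence (invSeq w)
invSeq-isInversionSequence {suc n} {w} w-perm i with view i
... | ‵fromℕ = begin
  invSeq w (fromℕ n)          ≡⟨ invSeq-fromℕ w-perm ⟩
  n ∸ toℕ (topPosition w)     ≤⟨ ℕP.m∸n≤m n (toℕ (topPosition w)) ⟩
  n                           ≡⟨ FinP.toℕ-fromℕ n ⟨
  toℕ (fromℕ n)               ∎
  where open ℕP.≤-Reasoning
... | ‵inject₁ j = begin
  invSeq w (inject₁ j)              ≡⟨ invSeq-inject₁ w-perm j ⟩
  invSeq (OneLine.remove w) j       ≤⟨ invSeq-isInversionSequence (OneLine.remove-isPerm w-perm) j ⟩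
  toℕ j                             ≡⟨ FinP.toℕ-inject₁ j ⟨
  toℕ (inject₁ j)                   ∎
  where open ℕP.≤-Reasoning

-- Inserting n at position k creates n ∸ k inversions at n (invSeq-oneLine-fromℕ).
decodeTop : (Fin (suc n) → ℕ) → Fin (suc n)
decodeTop {n} x = (n ∸ x (fromℕ n)) mod suc n

decode : (Fin n → ℕ) → Vec (Fin n) n
decode {zero}  x = []
decode {suc n} x = OneLine.insert (decode (x ∘ inject₁)) (decodeTop x)

decode-isPerm : (x : Fin n → ℕ) → IsPerm (decode x)
decode-isPerm {suc n} x = OneLine.insert-isPerm (decode (x ∘ inject₁)) (decodeTop x) (decode-isPerm (x ∘ inject₁))

invSeq-decode : {x : Fin n → ℕ} → IsInversionSequence x → ∀ i → invSeq (decode x) i ≡ x i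
invSeq-decode {suc n} {x} x-inv i with view i
... | ‵fromℕ = begin
  invSeq (decode x) (fromℕ n)  ≡⟨ invSeq-oneLine-fromℕ (decode-isPerm (x ∘ inject₁)) (decodeTop x) ⟩
  n ∸ toℕ (decodeTop x)        ≡⟨ cong (n ∸_) (toℕ-mod (s≤s (ℕP.m∸n≤m n (x (fromℕ n))))) ⟩
  n ∸ (n ∸ x (fromℕ n))        ≡⟨ ℕP.m∸[m∸n]≡n x-top≤n ⟩
  x (fromℕ n)                  ∎
  where
  open ≡-Reasoning
  x-top≤n : x (fromℕ n) ≤ n
  x-top≤n = subst (x (fromℕ n) ≤_) (FinP.toℕ-fromℕ n) (x-inv (fromℕ n))
... | ‵inject₁ j = trans (invSeq-oneLine-inject₁ (decode-isPerm (x ∘ inject₁)) (decodeTop x) j)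
                         (invSeq-decode (λ j → subst (x (inject₁ j) ≤_) (FinP.toℕ-inject₁ j) (x-inv (inject₁ j))) j)

-- The Euler characteristic

idPerm-isPerm : IsPerm (idPerm n)
idPerm-isPerm {n} j = subst (_∈ idPerm n) (VecP.lookup∘tabulate id j) (∈-lookup j (idPerm n))

invSeq-idPerm : ∀ i → invSeq (idPerm n) i ≡ 0
invSeq-idPerm {n} i = trans (invSeq≡inversionsAt (idPerm n) i) (∑-zero λ j →
  𝟙-no (inversion? (pos (idPerm n)) i j) (λ (j<i , lt) → ℕP.<-asym j<i (subst₂ _<_ (pos-idPerm i) (pos-idPerm j) lt)))
  where
  pos-idPerm : ∀ j → pos (idPerm n) j ≡ toℕ j
  pos-idPerm j = subst (λ v → pos (idPerm n) v ≡ toℕ j) (VecP.lookup∘tabulate id j)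
                       (pos-lookup {w = idPerm n} (lookup-injective idPerm-isPerm) j)

identity-or-inversion : {w : Vec (Fin n) n} → IsPerm w → w ≡ idPerm n ⊎ ∃ λ i → 0 < invSeq w i
identity-or-inversion {n} {w} w-perm with FinP.any? (λ i → 0 ℕ.<? invSeq w i)
... | yes inversion = inj₂ inversion
... | no ¬inversion = inj₁ (invSeq-injective w-perm idPerm-isPerm λ i →
  trans (ℕP.n≤0⇒n≡0 (ℕP.≮⇒≥ (λ 0<wi → ¬inversion (i , 0<wi)))) (sym (invSeq-idPerm i)))

nonzeros : (Fin n → ℕ) → ℕ
nonzeros {n} x = ∑[ i < n ] 𝟙 (0 ℕ.<? x i)

nonzeros-idPerm : nonzeros (invSeq (idPerm n)) ≡ 0
nonzeros-idPerm {n} = ∑-zero {n} (λ i → cong (𝟙 ∘ (0 ℕ.<?_)) (invSeq-idPerm i))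

nonzeros-⊓⊔ : (x y : Fin n → ℕ) →
              nonzeros x + nonzeros y ≡ nonzeros (λ i → x i ⊓ y i) + nonzeros (λ i → x i ⊔ y i)
nonzeros-⊓⊔ {n} x y = begin
  nonzeros x + nonzeros y
    ≡⟨ ∑-distrib-+ (𝟙 ∘ (0 ℕ.<?_) ∘ x) (𝟙 ∘ (0 ℕ.<?_) ∘ y) ⟨
  ∑[ i < n ] (𝟙 (0 ℕ.<? x i) + 𝟙 (0 ℕ.<? y i))
    ≡⟨ sum-cong-≗ {n} (λ i → ⊓⊔ (x i) (y i)) ⟩
  ∑[ i < n ] (𝟙 (0 ℕ.<? x i ⊓ y i) + 𝟙 (0 ℕ.<? x i ⊔ y i))
    ≡⟨ ∑-distrib-+ (λ i → 𝟙 (0 ℕ.<? x i ⊓ y i)) (λ i → 𝟙 (0 ℕ.<? x i ⊔ y i)) ⟩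
  nonzeros (λ i → x i ⊓ y i) + nonzeros (λ i → x i ⊔ y i)
    ∎
  where
  ⊓⊔ : ∀ a b → 𝟙 (0 ℕ.<? a) + 𝟙 (0 ℕ.<? b) ≡ 𝟙 (0 ℕ.<? a ⊓ b) + 𝟙 (0 ℕ.<? a ⊔ b)
  ⊓⊔ zero    b       = refl
  ⊓⊔ (suc a) zero    = refl
  ⊓⊔ (suc a) (suc b) = refl
  open ≡-Reasoning

nonzeros-invSeq-valuation : {v w m j : Vec (Fin n) n} → IsMeet v w m → IsJoin v w j →
  nonzeros (invSeq v) + nonzeros (invSeq w) ≡ nonzeros (invSeq m) + nonzeros (invSeq j)
nonzeros-invSeq-valuation {n} {v} {w} meet join = trans (nonzeros-⊓⊔ (invSeq v) (invSeq w))
  (cong₂ _+_ (sum-cong-≗ {n} (λ i → cong (𝟙 ∘ (0 ℕ.<?_)) (sym (meet i))))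
             (sum-cong-≗ {n} (λ i → cong (𝟙 ∘ (0 ℕ.<?_)) (sym (join i)))))

nonzeros-single : {x : Fin n → ℕ} (i : Fin n) → (∀ j → j ≢ i → x j ≡ 0) → 0 < x i → nonzeros x ≡ 1
nonzeros-single {x = x} i off-i 0<xi =
  trans (∑-single i (λ j j≢i → 𝟙-no (0 ℕ.<? x j) (ℕP.<-irrefl (sym (off-i j j≢i))))) (𝟙-yes (0 ℕ.<? x i) 0<xi)

rlNonMin≡nonzeros : {w : Vec (Fin n) n} → IsPerm w → rlNonMin w ≡ nonzeros (invSeq w)
rlNonMin≡nonzeros {n} {w} w-perm = begin
  rlNonMin w
    ≡⟨ countFin≡∑𝟙 smallerLater? ⟩
  ∑[ p < n ] 𝟙 (smallerLater? p)
    ≡⟨ sum-cong-≗ {n} (λ p → 𝟙-cong (smallerLater? p) (0 ℕ.<? _) (smallerLater⇔inversion p)) ⟩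
  ∑[ p < n ] 𝟙 (0 ℕ.<? invSeq w (lookup w p))
    ≡⟨ ∑-reindex-lookup w-perm (λ v → 𝟙 (0 ℕ.<? invSeq w v)) ⟩
  nonzeros (invSeq w)
    ∎
  where
  open ≡-Reasoning
  smallerLater? : ∀ p → Dec _
  smallerLater? p = FinP.any? (λ q → (toℕ p ℕ.<? toℕ q) ×-dec (toℕ (lookup w q) ℕ.<? toℕ (lookup w p)))
  pos-lookup-w : ∀ p → pos w (lookup w p) ≡ toℕ p
  pos-lookup-w = pos-lookup {w = w} (lookup-injective w-perm)
  smallerLater⇔inversion : ∀ p → (∃ λ q → toℕ p < toℕ q × toℕ (lookup w q) < toℕ (lookup w p))
                                 ⇔ 0 < invSeq w (lookup w p)
  smallerLater⇔inversion p = mk⇔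
    (λ (q , p<q , wq<wp) → subst (0 <_) (sym (invSeq≡inversionsAt w (lookup w p)))
      (Equivalence.from (0<∑𝟙⇔∃ (inversion? (pos w) (lookup w p)))
        (lookup w q , wq<wp , subst₂ _<_ (sym (pos-lookup-w p)) (sym (pos-lookup-w q)) p<q)))
    (λ 0<I → let (j , j<wp , wp<j) = Equivalence.to (0<∑𝟙⇔∃ (inversion? (pos w) (lookup w p)))
                                       (subst (0 <_) (invSeq≡inversionsAt w (lookup w p)) 0<I)
             in position w-perm j
              , subst₂ _<_ (pos-lookup-w p) (pos≡position w-perm j) wp<j
              , subst (λ v → toℕ v < toℕ (lookup w p)) (sym (lookup-position w-perm j)) j<wp)

module _ {c : Vec (Fin n) n} (c-perm : IsPerm c) {i : Fin n}
         (off-i : ∀ j → j ≢ i → invSeq c j ≡ 0) (0<ci : 0 < invSeq c i) where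

  singleInversion-joinIrreducible : JoinIrreducible c
  singleInversion-joinIrreducible = c-perm , c≢id , irreducible
    where
    c≢id : c ≢ idPerm n
    c≢id refl = ℕP.<-irrefl (sym (invSeq-idPerm i)) 0<ci
    dominant : ∀ {a b} → IsPerm a → IsJoin a b c → invSeq a i ≡ invSeq c i → c ≡ a
    dominant {a} {b} a-perm join ai≡ci = invSeq-injective c-perm a-perm agree
      where
      agree : ∀ j → invSeq c j ≡ invSeq a j
      agree j with j FinP.≟ i
      ... | yes refl = sym ai≡ci
      ... | no j≢i   = trans (off-i j j≢i) (sym (ℕP.n≤0⇒n≡0
        (subst (invSeq a j ≤_) (trans (sym (join j)) (off-i j j≢i)) (ℕP.m≤m⊔n _ _))))
    irreducible : ∀ a b → IsPerm a → IsPerm b → IsJoin a b c → c ≡ a ⊎ c ≡ b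
    irreducible a b a-perm b-perm join with ℕP.⊔-sel (invSeq a i) (invSeq b i)
    ... | inj₁ ⊔≡a = inj₁ (dominant {b = b} a-perm join (trans (sym ⊔≡a) (sym (join i))))
    ... | inj₂ ⊔≡b = inj₂ (dominant {b = a} b-perm (λ j → trans (join j) (ℕP.⊔-comm (invSeq a j) (invSeq b j)))
                                            (trans (sym ⊔≡b) (sym (join i))))

module Split {w : Vec (Fin n) n} (w-perm : IsPerm w) (i : Fin n) where

  restCode atomCode : Fin n → ℕ
  restCode j with j FinP.≟ i
  ... | yes _ = 0
  ... | no _  = invSeq w j
  atomCode j with j FinP.≟ i
  ... | yes _ = invSeq w j
  ... | no _  = 0

  restCode⊔atomCode : ∀ j → restCode j ⊔ atomCode j ≡ invSeq w j
  restCode⊔atomCode j with j FinP.≟ i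
  ... | yes _ = refl
  ... | no _  = ℕP.⊔-identityʳ (invSeq w j)

  restCode⊓atomCode : ∀ j → restCode j ⊓ atomCode j ≡ 0
  restCode⊓atomCode j with j FinP.≟ i
  ... | yes _ = refl
  ... | no _  = ℕP.⊓-zeroʳ (invSeq w j)

  rest atom : Vec (Fin n) n
  rest = decode restCode
  atom = decode atomCode

  invSeq-rest : ∀ j → invSeq rest j ≡ restCode j
  invSeq-rest = invSeq-decode λ j → ℕP.≤-trans (subst (restCode j ≤_) (restCode⊔atomCode j) (ℕP.m≤m⊔n _ _))
                                                (invSeq-isInversionSequence w-perm j)

  invSeq-atom : ∀ j → invSeq atom j ≡ atomCode j
  invSeq-atom = invSeq-decode λ j → ℕP.≤-trans (subst (atomCode j ≤_) (restCode⊔atomCode j) (ℕP.m≤n⊔m _ _))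
                                                (invSeq-isInversionSequence w-perm j)

  rest-isPerm : IsPerm rest
  rest-isPerm = decode-isPerm restCode

  atom-isPerm : IsPerm atom
  atom-isPerm = decode-isPerm atomCode

  rest⊓atom≡id : IsMeet rest atom (idPerm n)
  rest⊓atom≡id j = trans (invSeq-idPerm j) (sym (trans (cong₂ _⊓_ (invSeq-rest j) (invSeq-atom j)) (restCode⊓atomCode j)))

  rest⊔atom≡w : IsJoin rest atom w
  rest⊔atom≡w j = sym (trans (cong₂ _⊔_ (invSeq-rest j) (invSeq-atom j)) (restCode⊔atomCode j))

  invSeq-rest-i : invSeq rest i ≡ 0
  invSeq-rest-i with i FinP.≟ i | invSeq-rest i
  ... | yes _  | eq = eq
  ... | no i≢i | _  = contradiction refl i≢i

  invSeq-atom-i : invSeq atom i ≡ invSeq w i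
  invSeq-atom-i with i FinP.≟ i | invSeq-atom i
  ... | yes _  | eq = eq
  ... | no i≢i | _  = contradiction refl i≢i

  invSeq-atom-off : ∀ j → j ≢ i → invSeq atom j ≡ 0
  invSeq-atom-off j j≢i with j FinP.≟ i | invSeq-atom j
  ... | yes j≡i | _  = contradiction j≡i j≢i
  ... | no _    | eq = eq

  module _ (0<wi : 0 < invSeq w i) where

    atom-joinIrreducible : JoinIrreducible atom
    atom-joinIrreducible = singleInversion-joinIrreducible atom-isPerm invSeq-atom-off
                             (subst (0 <_) (sym invSeq-atom-i) 0<wi)

    nonzeros-atom : nonzeros (invSeq atom) ≡ 1
    nonzeros-atom = nonzeros-single i invSeq-atom-off (subst (0 <_) (sym invSeq-atom-i) 0<wi)

    nonzeros-rest< : nonzeros (invSeq rest) < nonzeros (invSeq w)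
    nonzeros-rest< = begin-strict
      nonzeros (invSeq rest)
        <⟨ ℕP.n<1+n _ ⟩
      suc (nonzeros (invSeq rest))
        ≡⟨ ℕP.+-comm 1 _ ⟩
      nonzeros (invSeq rest) + 1
        ≡⟨ cong (_+_ (nonzeros (invSeq rest))) nonzeros-atom ⟨
      nonzeros (invSeq rest) + nonzeros (invSeq atom)
        ≡⟨ nonzeros-invSeq-valuation {v = rest} {atom} {idPerm n} {w} rest⊓atom≡id rest⊔atom≡w ⟩
      nonzeros (invSeq (idPerm n)) + nonzeros (invSeq w)
        ≡⟨ cong (_+ nonzeros (invSeq w)) (nonzeros-idPerm {n}) ⟩
      nonzeros (invSeq w)
        ∎
      where open ℕP.≤-Reasoning

joinIrreducible⇒nonzeros≡1 : {a : Vec (Fin n) n} → JoinIrreducible a → nonzeros (invSeq a) ≡ 1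
joinIrreducible⇒nonzeros≡1 {a = a} (a-perm , a≢id , irreducible) with identity-or-inversion a-perm
... | inj₁ a≡id        = contradiction a≡id a≢id
... | inj₂ (i , 0<ai) = rest-or-atom (irreducible rest atom rest-isPerm atom-isPerm rest⊔atom≡w)
  where
  open Split a-perm i
  rest-or-atom : a ≡ rest ⊎ a ≡ atom → nonzeros (invSeq a) ≡ 1
  rest-or-atom (inj₁ a≡rest) = contradiction (trans (cong (λ v → invSeq v i) a≡rest) invSeq-rest-i) (ℕP.>⇒≢ 0<ai)
  rest-or-atom (inj₂ a≡atom) = trans (cong (nonzeros ∘ invSeq) a≡atom) (nonzeros-atom 0<ai)

split-valuation : {ν : Vec (Fin n) n → ℤ} → IsValuation n ν → {w : Vec (Fin n) n} (w-perm : IsPerm w) (i : Fin n) →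
                  ν w ≡ ν (Split.rest w-perm i) ℤ.+ ν (Split.atom w-perm i)
split-valuation {n} {ν} (ν-id , ν-modular) {w} w-perm i = begin
  ν w                         ≡⟨ ℤP.+-identityˡ (ν w) ⟨
  + 0 ℤ.+ ν w                 ≡⟨ cong (ℤ._+ ν w) ν-id ⟨
  ν (idPerm n) ℤ.+ ν w        ≡⟨ ν-modular rest atom (idPerm n) w rest-isPerm atom-isPerm idPerm-isPerm w-perm
                                             rest⊓atom≡id rest⊔atom≡w ⟨
  ν rest ℤ.+ ν atom           ∎
  where
  open ≡-Reasoning
  open Split w-perm i

module _ {ν μ : Vec (Fin n) n → ℤ} (ν-val : IsValuation n ν) (μ-val : IsValuation n μ)
         (ν≡μ-on-irreducibles : ∀ a → JoinIrreducible a → ν a ≡ μ a) where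

  valuations-agree : {w : Vec (Fin n) n} → IsPerm w → ν w ≡ μ w
  valuations-agree w-perm = go w-perm (<-wellFounded _)
    where
    go : {w : Vec (Fin n) n} → IsPerm w → Acc _<_ (nonzeros (invSeq w)) → ν w ≡ μ w
    go {w} w-perm (acc smaller) with identity-or-inversion w-perm
    ... | inj₁ refl       = trans (proj₁ ν-val) (sym (proj₁ μ-val))
    ... | inj₂ (i , 0<wi) = begin
      ν w                  ≡⟨ split-valuation ν-val w-perm i ⟩
      ν rest ℤ.+ ν atom    ≡⟨ cong₂ ℤ._+_ (go rest-isPerm (smaller (nonzeros-rest< 0<wi)))
                                          (ν≡μ-on-irreducibles atom (atom-joinIrreducible 0<wi)) ⟩
      μ rest ℤ.+ μ atom    ≡⟨ split-valuation μ-val w-perm i ⟨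
      μ w                  ∎
      where
      open ≡-Reasoning
      open Split w-perm i

rlNonMin-isEulerChar : IsEulerChar n (λ w → + rlNonMin w)
rlNonMin-isEulerChar {n} = (at-id , modular) , at-irreducible
  where
  at-id : + rlNonMin (idPerm n) ≡ + 0
  at-id = cong +_ (trans (rlNonMin≡nonzeros (idPerm-isPerm {n})) (nonzeros-idPerm {n}))
  modular : ∀ v w m j → IsPerm v → IsPerm w → IsPerm m → IsPerm j → IsMeet v w m → IsJoin v w j →
            + rlNonMin v ℤ.+ + rlNonMin w ≡ + rlNonMin m ℤ.+ + rlNonMin j
  modular v w m j v-perm w-perm m-perm j-perm meet join = begin
    + rlNonMin v ℤ.+ + rlNonMin w   ≡⟨ ℤP.pos-+ (rlNonMin v) (rlNonMin w) ⟨
    + (rlNonMin v + rlNonMin w)     ≡⟨ cong +_ ℕ-modular ⟩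
    + (rlNonMin m + rlNonMin j)     ≡⟨ ℤP.pos-+ (rlNonMin m) (rlNonMin j) ⟩
    + rlNonMin m ℤ.+ + rlNonMin j   ∎
    where
    open ≡-Reasoning
    ℕ-modular : rlNonMin v + rlNonMin w ≡ rlNonMin m + rlNonMin j
    ℕ-modular rewrite rlNonMin≡nonzeros v-perm | rlNonMin≡nonzeros w-perm
                    | rlNonMin≡nonzeros m-perm | rlNonMin≡nonzeros j-perm
                    = nonzeros-invSeq-valuation {v = v} {w} {m} {j} meet join
  at-irreducible : ∀ a → JoinIrreducible a → + rlNonMin a ≡ + 1
  at-irreducible a a-irr = cong +_ (trans (rlNonMin≡nonzeros (proj₁ a-irr)) (joinIrreducible⇒nonzeros≡1 a-irr))

eulerChar≡rlNonMin : {χ : Vec (Fin n) n → ℤ} → IsEulerChar n χ →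
                     {w : Vec (Fin n) n} → IsPerm w → χ w ≡ + rlNonMin w
eulerChar≡rlNonMin (χ-val , χ-irr) = valuations-agree χ-val (proj₁ rlNonMin-isEulerChar)
  λ a a-irr → trans (χ-irr a a-irr) (sym (proj₂ rlNonMin-isEulerChar a a-irr))

-- Cycle minima

iter-+ : {A : Set} (a b : ℕ) (f : A → A) (x : A) → iter (a + b) f x ≡ iter a f (iter b f x)
iter-+ zero    b f x = refl
iter-+ (suc a) b f x = cong f (iter-+ a b f x)

iter-injective : {A : Set} (a : ℕ) {f : A → A} → Injective _≡_ _≡_ f → Injective _≡_ _≡_ (iter a f)
iter-injective zero    f-inj eq = eq
iter-injective (suc a) f-inj eq = iter-injective a f-inj (f-inj eq)

iter-*-fixed : {A : Set} (q d : ℕ) {f : A → A} {x : A} → iter d f x ≡ x → iter (q * d) f x ≡ x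
iter-*-fixed zero    d           back = refl
iter-*-fixed (suc q) d {f} {x} back = trans (iter-+ d (q * d) f x) (trans (cong (iter d f) (iter-*-fixed q d back)) back)

iter-period : {f : Fin n → Fin n} → Injective _≡_ _≡_ f → ∀ x → ∃ λ d → 0 < d × d ≤ n × iter d f x ≡ x
iter-period {n} {f} f-inj x
  with i , j , i<j , same ← FinP.pigeonhole (ℕP.n<1+n n) (λ a → iter (toℕ a) f x)
  = toℕ j ∸ toℕ i , ℕP.m<n⇒0<n∸m i<j , ℕP.≤-trans (ℕP.m∸n≤m (toℕ j) (toℕ i)) (FinP.toℕ≤pred[n] j) , returns
  where
  returns : iter (toℕ j ∸ toℕ i) f x ≡ x
  returns = sym (iter-injective (toℕ i) f-inj (trans same (trans
    (cong (λ e → iter e f x) (sym (ℕP.m+[n∸m]≡n (ℕP.<⇒≤ i<j)))) (iter-+ (toℕ i) (toℕ j ∸ toℕ i) f x))))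

IsCycleMin : (Fin n → Fin n) → Fin n → Set
IsCycleMin f i = ∀ m → toℕ i ≤ toℕ (iter m f i)

cycleMin? : (f : Fin n → Fin n) (i : Fin n) → Dec (∀ (m : Fin n) → toℕ i ≤ toℕ (iter (toℕ m) f i))
cycleMin? f i = FinP.all? (λ m → toℕ i ℕ.≤? toℕ (iter (toℕ m) f i))

-- `cycles` only inspects the first n iterates; an injective map comes back within n
-- steps, so this is no restriction.
boundedCycleMin⇔ : {f : Fin n → Fin n} → Injective _≡_ _≡_ f → ∀ i →
                   (∀ (m : Fin n) → toℕ i ≤ toℕ (iter (toℕ m) f i)) ⇔ IsCycleMin f i
boundedCycleMin⇔ {n} {f} f-inj i = mk⇔ unbounded (λ min m → min (toℕ m))
  where
  unbounded : (∀ (m : Fin n) → toℕ i ≤ toℕ (iter (toℕ m) f i)) → IsCycleMin f i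
  unbounded bounded m with d , 0<d , d≤n , back ← iter-period f-inj i =
    subst (λ y → toℕ i ≤ toℕ y) (sym reduce)
          (subst (λ e → toℕ i ≤ toℕ (iter e f i)) (FinP.toℕ-fromℕ< r<n) (bounded (fromℕ< r<n)))
    where
    instance
      d-nonZero : ℕ.NonZero d
      d-nonZero = ℕ.>-nonZero 0<d
    r<n : m % d < n
    r<n = ℕP.<-≤-trans (m%n<n m d) d≤n
    reduce : iter m f i ≡ iter (m % d) f i
    reduce = trans (cong (λ e → iter e f i) (m≡m%n+[m/n]*n m d))
                   (trans (iter-+ (m % d) ((m / d) * d) f i) (cong (iter (m % d) f) (iter-*-fixed (m / d) d back)))

isCycleMin-fromℕ⇔ : (f : Fin (suc n) → Fin (suc n)) → IsCycleMin f (fromℕ n) ⇔ f (fromℕ n) ≡ fromℕ n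
isCycleMin-fromℕ⇔ {n} f = mk⇔ fixed (λ fixed m → ℕP.≤-reflexive (cong toℕ (sym (stays fixed m))))
  where
  fixed : IsCycleMin f (fromℕ n) → f (fromℕ n) ≡ fromℕ n
  fixed min = FinP.toℕ-injective (trans (ℕP.≤-antisym (FinP.toℕ≤pred[n] (f (fromℕ n)))
    (subst (_≤ toℕ (f (fromℕ n))) (FinP.toℕ-fromℕ n) (min 1))) (sym (FinP.toℕ-fromℕ n)))
  stays : f (fromℕ n) ≡ fromℕ n → ∀ m → iter m f (fromℕ n) ≡ fromℕ n
  stays fixed zero    = refl
  stays fixed (suc m) = trans (cong f (stays fixed m)) fixed

ExtendsViaTop : (Fin (suc n) → Fin (suc n)) → (Fin n → Fin n) → Set
ExtendsViaTop {n} f g =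
  ∀ q → f (inject₁ q) ≡ inject₁ (g q) ⊎ (f (inject₁ q) ≡ fromℕ n × f (fromℕ n) ≡ inject₁ (g q))

module _ {f : Fin (suc n) → Fin (suc n)} {g : Fin n → Fin n} (f≈g : ExtendsViaTop f g) where

  iter-reaches : ∀ x a → ∃ λ m → iter m f (inject₁ x) ≡ inject₁ (iter a g x)
  iter-reaches x zero = 0 , refl
  iter-reaches x (suc a) with m , eq ← iter-reaches x a | f≈g (iter a g x)
  ... | inj₁ direct              = suc m , trans (cong f eq) direct
  ... | inj₂ (to-top , from-top) = suc (suc m) , trans (cong (f ∘ f) eq) (trans (cong f to-top) from-top)

  iter-visits : ∀ x m → (∃ λ a → iter m f (inject₁ x) ≡ inject₁ (iter a g x))
                      ⊎ (iter m f (inject₁ x) ≡ fromℕ n × ∃ λ a → f (fromℕ n) ≡ inject₁ (iter a g x))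
  iter-visits x zero = inj₁ (0 , refl)
  iter-visits x (suc m) with iter-visits x m
  ... | inj₂ (at-top , a , from-top) = inj₁ (a , trans (cong f at-top) from-top)
  ... | inj₁ (a , eq) with f≈g (iter a g x)
  ...   | inj₁ direct              = inj₁ (suc a , trans (cong f eq) direct)
  ...   | inj₂ (to-top , from-top) = inj₂ (trans (cong f eq) to-top , suc a , from-top)

  isCycleMin-inject₁⇔ : ∀ x → IsCycleMin f (inject₁ x) ⇔ IsCycleMin g x
  isCycleMin-inject₁⇔ x = mk⇔ to from
    where
    to : IsCycleMin f (inject₁ x) → IsCycleMin g x
    to min a with m , eq ← iter-reaches x a =
      subst₂ _≤_ (FinP.toℕ-inject₁ x) (trans (cong toℕ eq) (FinP.toℕ-inject₁ _)) (min m)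
    from : IsCycleMin g x → IsCycleMin f (inject₁ x)
    from min m with iter-visits x m
    ... | inj₁ (a , eq)    =
      subst₂ _≤_ (sym (FinP.toℕ-inject₁ x)) (sym (trans (cong toℕ eq) (FinP.toℕ-inject₁ _))) (min a)
    ... | inj₂ (at-top , _) = ℕP.<⇒≤ (subst (toℕ (inject₁ x) <_) (sym (trans (cong toℕ at-top) (FinP.toℕ-fromℕ n)))
                                             (FinP.inject₁ℕ< x))

module _ (i j : Fin n) where

  transpose-matchˡ : PC.transpose i j i ≡ j
  transpose-matchˡ rewrite dec-true (i FinP.≟ i) refl = refl

  transpose-matchʳ : PC.transpose i j j ≡ i
  transpose-matchʳ with j FinP.≟ i
  ... | yes j≡i = j≡i
  ... | no _ rewrite dec-true (j FinP.≟ j) refl = refl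

  transpose-other : ∀ {k} → k ≢ i → k ≢ j → PC.transpose i j k ≡ k
  transpose-other {k} k≢i k≢j rewrite dec-false (k FinP.≟ i) k≢i | dec-false (k FinP.≟ j) k≢j = refl

-- Insertion of n into the cycle of k right after k (as a fixed point if k is the top).
cycleInsertion : TopInsertion
cycleInsertion = record
  { placement     = λ k → Perm.transpose k (fromℕ _)
  ; placement-top = λ k → transpose-matchˡ k (fromℕ _)
  }

module Cycle = Insertion cycleInsertion

cycleInsert-extendsViaTop : (u : Vec (Fin n) n) (k : Fin (suc n)) → ExtendsViaTop (lookup (Cycle.insert u k)) (lookup u)
cycleInsert-extendsViaTop {n} u k q with inject₁ q FinP.≟ k
... | yes refl = inj₂ (Cycle.lookup-insert-top u k , (begin
  lookup (Cycle.insert u k) (fromℕ n)     ≡⟨ Cycle.lookup-insert u k (fromℕ n) ⟩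
  extend u (PC.transpose k (fromℕ n) (fromℕ n)) ≡⟨ cong (extend u) (transpose-matchʳ k (fromℕ n)) ⟩
  extend u (inject₁ q)                    ≡⟨ extend-inject₁ u q ⟩
  inject₁ (lookup u q)                    ∎))
  where open ≡-Reasoning
... | no q≢k = inj₁ (begin
  lookup (Cycle.insert u k) (inject₁ q)   ≡⟨ Cycle.lookup-insert u k (inject₁ q) ⟩
  extend u (PC.transpose k (fromℕ n) (inject₁ q))
    ≡⟨ cong (extend u) (transpose-other k (fromℕ n) q≢k (FinP.fromℕ≢inject₁ ∘ sym)) ⟩
  extend u (inject₁ q)                    ≡⟨ extend-inject₁ u q ⟩
  inject₁ (lookup u q)                    ∎)
  where open ≡-Reasoning

cycles-cycleInsert : {u : Vec (Fin n) n} → IsPerm u → (k : Fin (suc n)) →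
                     cycles (Cycle.insert u k) ≡ cycles u + 𝟙 (k FinP.≟ fromℕ n)
cycles-cycleInsert {n} {u} u-perm k = begin
  cycles w
    ≡⟨ countFin≡∑𝟙 (cycleMin? f) ⟩
  ∑[ p < suc n ] 𝟙 (cycleMin? f p)
    ≡⟨ sum-init-last {n} (𝟙 ∘ cycleMin? f) ⟩
  ∑[ x < n ] 𝟙 (cycleMin? f (inject₁ x)) + 𝟙 (cycleMin? f (fromℕ n))
    ≡⟨ cong₂ _+_ (sum-cong-≗ {n} lower) top ⟩
  ∑[ x < n ] 𝟙 (cycleMin? (lookup u) x) + 𝟙 (k FinP.≟ fromℕ n)
    ≡⟨ cong (_+ _) (countFin≡∑𝟙 (cycleMin? (lookup u))) ⟨
  cycles u + 𝟙 (k FinP.≟ fromℕ n)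
    ∎
  where
  open ≡-Reasoning
  w = Cycle.insert u k
  f = lookup w
  f-inj = lookup-injective (Cycle.insert-isPerm u k u-perm)
  lower : ∀ x → 𝟙 (cycleMin? f (inject₁ x)) ≡ 𝟙 (cycleMin? (lookup u) x)
  lower x = 𝟙-cong (cycleMin? f (inject₁ x)) (cycleMin? (lookup u) x)
    (⇔-sym (boundedCycleMin⇔ (lookup-injective u-perm) x)
      ⇔-∘ (isCycleMin-inject₁⇔ (cycleInsert-extendsViaTop u k) x
      ⇔-∘ boundedCycleMin⇔ f-inj (inject₁ x)))
  f-top⇔ : f (fromℕ n) ≡ fromℕ n ⇔ k ≡ fromℕ n
  f-top⇔ = mk⇔ (λ fixed → extend≡fromℕ⇒ u k (trans (cong (extend u) (sym (transpose-matchʳ k (fromℕ n))))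
                                                 (trans (sym (Cycle.lookup-insert u k (fromℕ n))) fixed)))
               (λ { refl → Cycle.lookup-insert-top u k })
  top : 𝟙 (cycleMin? f (fromℕ n)) ≡ 𝟙 (k FinP.≟ fromℕ n)
  top = 𝟙-cong (cycleMin? f (fromℕ n)) (k FinP.≟ fromℕ n)
    (f-top⇔ ⇔-∘ (isCycleMin-fromℕ⇔ f ⇔-∘ boundedCycleMin⇔ f-inj (fromℕ n)))

-- The bijection Θ and counting

transfer : (ρ σ : TopInsertion) → Vec (Fin n) n → Vec (Fin n) n
transfer {zero}  ρ σ w = w
transfer {suc n} ρ σ w = Insertion.insert σ (transfer ρ σ (Insertion.remove ρ w)) (topPosition w)

module _ (ρ σ : TopInsertion) where

  private
    module ρ = Insertion ρ
    module σ = Insertion σ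

  transfer-isPerm : {w : Vec (Fin n) n} → IsPerm w → IsPerm (transfer ρ σ w)
  transfer-isPerm {zero}  w-perm = w-perm
  transfer-isPerm {suc n} w-perm = σ.insert-isPerm _ _ (transfer-isPerm (ρ.remove-isPerm w-perm))

  transfer-inverse : {w : Vec (Fin n) n} → IsPerm w → transfer σ ρ (transfer ρ σ w) ≡ w
  transfer-inverse {zero}  {[]} _      = refl
  transfer-inverse {suc n} {w}  w-perm = begin
    ρ.insert (transfer σ ρ (σ.remove (σ.insert v k))) (topPosition (σ.insert v k))
      ≡⟨ cong₂ (λ u k′ → ρ.insert (transfer σ ρ u) k′)
               (σ.remove-insert v k v-perm) (σ.topPosition-insert v k v-perm) ⟩
    ρ.insert (transfer σ ρ v) k
      ≡⟨ cong (λ u → ρ.insert u k) (transfer-inverse (ρ.remove-isPerm w-perm)) ⟩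
    ρ.insert (ρ.remove w) k
      ≡⟨ ρ.insert-remove w-perm ⟩
    w ∎
    where
    open ≡-Reasoning
    k = topPosition w
    v = transfer ρ σ (ρ.remove w)
    v-perm = transfer-isPerm (ρ.remove-isPerm w-perm)

Θ : Vec (Fin n) n → Vec (Fin n) n
Θ = transfer oneLineInsertion cycleInsertion

notTop+top≡1 : (k : Fin (suc n)) → 𝟙 (0 ℕ.<? n ∸ toℕ k) + 𝟙 (k FinP.≟ fromℕ n) ≡ 1
notTop+top≡1 {n} k with view k
... | ‵fromℕ rewrite FinP.toℕ-fromℕ n | ℕP.n∸n≡0 n = 𝟙-yes (fromℕ n FinP.≟ fromℕ n) refl
... | ‵inject₁ q = cong₂ _+_ (𝟙-yes (0 ℕ.<? _) (ℕP.m<n⇒0<n∸m (FinP.inject₁ℕ< q)))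
                            (𝟙-no (_ FinP.≟ _) (FinP.fromℕ≢inject₁ ∘ sym))

rlNonMin-oneLine : {w : Vec (Fin (suc n)) (suc n)} → IsPerm w →
                   rlNonMin w ≡ rlNonMin (OneLine.remove w) + 𝟙 (0 ℕ.<? n ∸ toℕ (topPosition w))
rlNonMin-oneLine {n} {w} w-perm = begin
  rlNonMin w
    ≡⟨ rlNonMin≡nonzeros w-perm ⟩
  nonzeros (invSeq w)
    ≡⟨ sum-init-last {n} (λ i → 𝟙 (0 ℕ.<? invSeq w i)) ⟩
  ∑[ i < n ] 𝟙 (0 ℕ.<? invSeq w (inject₁ i)) + 𝟙 (0 ℕ.<? invSeq w (fromℕ n))
    ≡⟨ cong₂ _+_ (sum-cong-≗ {n} (λ i → cong (𝟙 ∘ (0 ℕ.<?_)) (invSeq-inject₁ w-perm i)))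
                 (cong (𝟙 ∘ (0 ℕ.<?_)) (invSeq-fromℕ w-perm)) ⟩
  nonzeros (invSeq (OneLine.remove w)) + 𝟙 (0 ℕ.<? n ∸ toℕ (topPosition w))
    ≡⟨ cong (_+ 𝟙 (0 ℕ.<? n ∸ toℕ (topPosition w))) (rlNonMin≡nonzeros (OneLine.remove-isPerm w-perm)) ⟨
  rlNonMin (OneLine.remove w) + 𝟙 (0 ℕ.<? n ∸ toℕ (topPosition w))
    ∎
  where open ≡-Reasoning

rlNonMin+cycles∘Θ : {w : Vec (Fin n) n} → IsPerm w → rlNonMin w + cycles (Θ w) ≡ n
rlNonMin+cycles∘Θ {zero}  {[]} _      = refl
rlNonMin+cycles∘Θ {suc n} {w}  w-perm = begin
  rlNonMin w + cycles (Cycle.insert (Θ u) k)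
    ≡⟨ cong₂ _+_ (rlNonMin-oneLine w-perm) (cycles-cycleInsert (transfer-isPerm oneLineInsertion cycleInsertion u-perm) k) ⟩
  (rlNonMin u + 𝟙 (0 ℕ.<? n ∸ toℕ k)) + (cycles (Θ u) + 𝟙 (k FinP.≟ fromℕ n))
    ≡⟨ +-interchange (rlNonMin u) _ (cycles (Θ u)) _ ⟩
  (rlNonMin u + cycles (Θ u)) + (𝟙 (0 ℕ.<? n ∸ toℕ k) + 𝟙 (k FinP.≟ fromℕ n))
    ≡⟨ cong₂ _+_ (rlNonMin+cycles∘Θ u-perm) (notTop+top≡1 k) ⟩
  n + 1
    ≡⟨ ℕP.+-comm n 1 ⟩
  suc n ∎
  where
  open ≡-Reasoning
  u = OneLine.remove w
  u-perm = OneLine.remove-isPerm w-perm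
  k = topPosition w

countL-map : {A : Set} {P : Pred A 0ℓ} (P? : Decidable P) (f : A → A) (xs : List A) →
             countL P? (List.map f xs) ≡ countL (P? ∘ f) xs
countL-map P? f []       = refl
countL-map P? f (x ∷ xs) with P? (f x)
... | yes _ = cong suc (countL-map P? f xs)
... | no _  = countL-map P? f xs

countL-bijection : {A : Set} {P : Pred A 0ℓ} (P? : Decidable P) {f g : A → A} →
                   (∀ x → g (f x) ≡ x) → (∀ x → f (g x) ≡ x) →
                   {xs : List A} → Unique xs → (∀ x → x ∈ₗ xs) → countL (P? ∘ f) xs ≡ countL P? xs
countL-bijection P? {f} {g} gf fg {xs} xs-unique xs-complete =
  trans (sym (countL-map P? f xs)) (PermP.↭-length (PermP.filter-↭ P? (∼bag⇒↭ map-f-xs∼xs)))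
  where
  f-injective : ∀ {x y} → f x ≡ f y → x ≡ y
  f-injective {x} {y} fx≡fy = trans (sym (gf x)) (trans (cong g fx≡fy) (gf y))
  map-f-xs∼xs : List.map f xs ∼[ bag ] xs
  map-f-xs∼xs = unique∧set⇒bag (UniqueP.map⁺ f-injective xs-unique) xs-unique
    (λ {x} → mk⇔ (λ _ → xs-complete x)
                 (λ _ → subst (_∈ₗ List.map f xs) (fg x) (ListMemP.∈-map⁺ f (xs-complete (g x)))))

words-complete : ∀ n m (v : Vec (Fin n) m) → v ∈ₗ words n m
words-complete n zero    []      = ListAny.here refl
words-complete n (suc m) (x ∷ v) = ListMemP.∈-concat⁺′ (ListMemP.∈-map⁺ (x ∷_) (words-complete n m v))
                                     (ListMemP.∈-map⁺ (λ i → List.map (i ∷_) (words n m)) (ListMemP.∈-allFin x))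

words-unique : ∀ n m → Unique (words n m)
words-unique n zero    = All.[] AllPairs.∷ AllPairs.[]
words-unique n (suc m) = UniqueP.concat⁺
  (AllP.map⁺ (All.universal (λ i → UniqueP.map⁺ VecP.∷-injectiveʳ (words-unique n m)) _))
  (AllPairsP.map⁺ (AllPairs.map disjoint (UniqueP.allFin⁺ n)))
  where
  disjoint : ∀ {i j} → i ≢ j → Disjoint (List.map (i ∷_) (words n m)) (List.map (j ∷_) (words n m))
  disjoint i≢j (v∈i , v∈j) with ListMemP.∈-map⁻ _ v∈i | ListMemP.∈-map⁻ _ v∈j
  ... | _ , _ , refl | _ , _ , eq = i≢j (VecP.∷-injectiveˡ eq)

-- Extension by the identity outside S_n, so that counts over all words can be compared.
onPerms : (Vec (Fin n) n → Vec (Fin n) n) → Vec (Fin n) n → Vec (Fin n) n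
onPerms F w with isPerm? w
... | yes _ = F w
... | no _  = w

module _ (F : Vec (Fin n) n → Vec (Fin n) n) {w : Vec (Fin n) n} where

  onPerms-isPerm : IsPerm w → onPerms F w ≡ F w
  onPerms-isPerm w-perm with isPerm? w
  ... | yes _      = refl
  ... | no ¬w-perm = contradiction w-perm ¬w-perm

  onPerms-¬isPerm : ¬ IsPerm w → onPerms F w ≡ w
  onPerms-¬isPerm ¬w-perm with isPerm? w
  ... | yes w-perm = contradiction w-perm ¬w-perm
  ... | no _       = refl

countPerms-cong : {P Q : Pred (Vec (Fin n) n) 0ℓ} (P? : Decidable P) (Q? : Decidable Q) →
                  (∀ {w} → IsPerm w → P w ⇔ Q w) → countPerms n P? ≡ countPerms n Q?
countPerms-cong {n} P? Q? P⇔Q = cong List.length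
  (ListP.filter-≐ (λ w → isPerm? w ×-dec P? w) (λ w → isPerm? w ×-dec Q? w)
    ( (λ (w-perm , Pw) → w-perm , Equivalence.to (P⇔Q w-perm) Pw)
    , (λ (w-perm , Qw) → w-perm , Equivalence.from (P⇔Q w-perm) Qw))
    (words n n))

onPerms-inverse : {F G : Vec (Fin n) n → Vec (Fin n) n} → (∀ {w} → IsPerm w → IsPerm (F w)) →
                  (∀ {w} → IsPerm w → G (F w) ≡ w) → ∀ w → onPerms G (onPerms F w) ≡ w
onPerms-inverse {F = F} {G} F-isPerm GF w with isPerm? w
... | yes w-perm = trans (onPerms-isPerm G (F-isPerm w-perm)) (GF w-perm)
... | no ¬w-perm = onPerms-¬isPerm G ¬w-perm

module _ {F G : Vec (Fin n) n → Vec (Fin n) n}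
         (F-isPerm : ∀ {w} → IsPerm w → IsPerm (F w)) (G-isPerm : ∀ {w} → IsPerm w → IsPerm (G w))
         (GF : ∀ {w} → IsPerm w → G (F w) ≡ w) (FG : ∀ {w} → IsPerm w → F (G w) ≡ w) where

  countPerms-bijection : {P : Pred (Vec (Fin n) n) 0ℓ} (P? : Decidable P) → countPerms n (P? ∘ F) ≡ countPerms n P?
  countPerms-bijection {P = P} P? = trans
    (cong List.length (ListP.filter-≐ (λ w → isPerm? w ×-dec P? (F w))
                                      (λ w → isPerm? (onPerms F w) ×-dec P? (onPerms F w))
                                      ((λ {w} → to w) , (λ {w} → from w)) (words n n)))
    (countL-bijection (λ w → isPerm? w ×-dec P? w) (onPerms-inverse F-isPerm GF) (onPerms-inverse G-isPerm FG)
                      (words-unique n n) (words-complete n n))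
    where
    to : ∀ w → IsPerm w × P (F w) → IsPerm (onPerms F w) × P (onPerms F w)
    to w (w-perm , PFw) = subst (λ v → IsPerm v × P v) (sym (onPerms-isPerm F w-perm)) (F-isPerm w-perm , PFw)
    from : ∀ w → IsPerm (onPerms F w) × P (onPerms F w) → IsPerm w × P (F w)
    from w (Fw-perm , PFw) with isPerm? w
    ... | yes w-perm = w-perm , PFw
    ... | no ¬w-perm = contradiction Fw-perm ¬w-perm

eulerChar≡⇔cycles∘Θ : {χ : Vec (Fin n) n → ℤ} → IsEulerChar n χ → {w : Vec (Fin n) n} → IsPerm w →
                       ∀ k → χ w ≡ + k ⇔ cycles (Θ w) + k ≡ n
eulerChar≡⇔cycles∘Θ {n} {χ} χ-euler {w} w-perm k = mk⇔ to from
  where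
  χw = eulerChar≡rlNonMin χ-euler w-perm
  total = rlNonMin+cycles∘Θ w-perm
  to : χ w ≡ + k → cycles (Θ w) + k ≡ n
  to χw≡k = trans (cong (_+_ (cycles (Θ w))) (sym (ℤP.+-injective (trans (sym χw) χw≡k))))
                  (trans (ℕP.+-comm (cycles (Θ w)) (rlNonMin w)) total)
  from : cycles (Θ w) + k ≡ n → χ w ≡ + k
  from total′ = trans χw (cong +_ (ℕP.+-cancelˡ-≡ (cycles (Θ w)) (rlNonMin w) k
    (trans (ℕP.+-comm (cycles (Θ w)) (rlNonMin w)) (trans total (sym total′)))))

theorem4p4 : (n : ℕ) →
    Σ (Vec (Fin n) n → ℤ) (IsEulerChar n) ×
    ((χ : Vec (Fin n) n → ℤ) → IsEulerChar n χ →
      ((w : Vec (Fin n) n) → IsPerm w → χ w ≡ + rlNonMin w) ×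
      ((k : ℕ) → countPerms n (λ w → χ w ℤP.≟ + k)
                 ≡ countPerms n (λ w → cycles w + k ℕP.≟ n)))
theorem4p4 n = (_ , rlNonMin-isEulerChar) , λ χ χ-euler →
  (λ w → eulerChar≡rlNonMin χ-euler) ,
  λ k → begin
    countPerms n (λ w → χ w ℤP.≟ + k)
      ≡⟨ countPerms-cong _ _ (λ w-perm → eulerChar≡⇔cycles∘Θ χ-euler w-perm k) ⟩
    countPerms n (λ w → cycles (Θ w) + k ℕP.≟ n)
      ≡⟨ countPerms-bijection {n = n}
           (transfer-isPerm oneLineInsertion cycleInsertion) (transfer-isPerm cycleInsertion oneLineInsertion)
           (transfer-inverse oneLineInsertion cycleInsertion) (transfer-inverse cycleInsertion oneLineInsertion)
           (λ w → cycles w + k ℕP.≟ n) ⟩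
    countPerms n (λ w → cycles w + k ℕP.≟ n)
      ∎
  where open ≡-Reasoning
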